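{- Let $\langle X_1,\mathcal{T}_1,R_1\rangle$ and $\langle X_2,\mathcal{T}_2,R_2\rangle$ be $\mathcal{S}$-monotonic $DS$-spaces and let $S\subseteq X_1\times X_2$ be a meet-relation. Then the condition "for all $x\in X_1$ and every $U\in D(X_2)$: $X_2-U\in R_2[S(x)]$ iff $S^{ -1}[X_2-U]\in R_1(x)$" is equivalent to the condition $h_S(m_{R_2}(U))=m_{R_1}(h_S(U))$ for all $U\in D(X_2)$, i.e., to $h_S\colon D(X_2)\to D(X_1)$ being a homomorphism of monotonic distributive semilattices.
   Context: For a topological space $X$: $\mathcal{KO}(X)$ compact open subsets, $D(X)=\{U:X-U\in\mathcal{KO}(X)\}$, $\mathcal{S}(X)$ the set of all $\bigcap\mathcal{L}$ for dually directed (under inclusion) $\mathcal{L}\subseteq\mathcal{KO}(X)$. A $DS$-space is one in which $\mathcal{KO}(X)$ is a basis and which is sober. For $R\subseteq X\times\mathcal{S}(X)$: $R(x)=\{Z:(x,Z)\in R\}$, $m_R(U)=\{x:\forall Z\in R(x)\,(Z\cap U\ne\emptyset)\}$, $L_U=\{Z\in\mathcal{S}(X):Z\cap U\ne\emptyset\}$. An $\mathcal{S}$-monotonic $DS$-space is a $DS$-space with $R\subseteq X\times\mathcal{S}(X)$ such that $m_R(U)\in D(X)$ for all $U\in D(X)$ and $R(x)=\bigcap\{L_U:U\in D(X),x\in m_R(U)\}$ for all $x$; then $\langle D(X),\cap,m_R,X\rangle$ is a monotonic distributive semilattice. For $S\subseteq X_1\times X_2$: $S(x)=\{y:(x,y)\in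 S\}$, $h_S(U)=\{x\in X_1:S(x)\subseteq U\}$, $S^{ -1}[W]=\{x\in X_1:\exists y\in W,(x,y)\in S\}$, $R_2[S(x)]=\{Z\in\mathcal{S}(X_2):\exists y\in S(x),(y,Z)\in R_2\}$. A meet-relation is $S$ with $h_S(U)\in D(X_1)$ for all $U\in D(X_2)$ and $S(x)=\bigcap\{U\in D(X_2):S(x)\subseteq U\}$ for all $x\in X_1$. A homomorphism of monotonic distributive semilattices preserves $\wedge$ (here $\cap$), top and commutes with the operators. -}

module Defs where

import Level
open import Level using (0ℓ)
open import Data.Unit using (⊤)
open import Data.Product using (Σ; ∃; _×_; _,_)
open import Data.Sum using (_⊎_)
open import Data.List using (List)
open import Data.List.Relation.Unary.All using (All)
open import Data.List.Relation.Unary.Any using (Any)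
open import Relation.Binary.PropositionalEquality using (_≡_)
open import Relation.Unary using (Pred; _⊆_; _≐_; _∩_; _∪_; ∁)
open import Function.Bundles using (_⇔_)

Subset : Set → Set₁
Subset A = Pred A 0ℓ

record Space : Set₁ where
  field
    Carrier   : Set
    Open      : Subset Carrier → Set
    open-resp : ∀ {U V} → U ≐ V → Open U → Open V
    open-full : Open (λ _ → ⊤)
    open-∩    : ∀ {U V} → Open U → Open V → Open (U ∩ V)
    open-⋃    : (I : Set) (F : I → Subset Carrier) → (∀ i → Open (F i))
              → Open (λ x → ∃ λ i → F i x)

module _ (X : Space) where
  open Space X

  Compact : Subset Carrier → Set₁
  Compact K = (I : Set) (F : I → Subset Carrier) → (∀ i → Open (F i))
            → K ⊆ (λ x → ∃ λ i → F i x)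
            → ∃ λ (is : List I) → K ⊆ (λ x → Any (λ i → F i x) is)

  KO : Subset Carrier → Set₁
  KO K = Compact K × Open K

  -- membership in KO(X) for a predicate of any universe level,
  -- up to extensional equality of subsets
  InKO : ∀ {ℓ} → Pred Carrier ℓ → Set (Level.suc 0ℓ Level.⊔ ℓ)
  InKO P = ∃ λ (K : Subset Carrier) → KO K × K ≐ P

  InD : ∀ {ℓ} → Pred Carrier ℓ → Set (Level.suc 0ℓ Level.⊔ ℓ)
  InD U = InKO (∁ U)

  Closed : Subset Carrier → Set
  Closed C = Open (∁ C)

  cl : Carrier → Pred Carrier (Level.suc 0ℓ)
  cl x y = ∀ (C : Subset Carrier) → Closed C → C x → C y

  Irreducible : Subset Carrier → Set₁
  Irreducible C = (∃ λ x → C x)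
                × (∀ C₁ C₂ → Closed C₁ → Closed C₂ → C ⊆ (C₁ ∪ C₂) → (C ⊆ C₁) ⊎ (C ⊆ C₂))

  Sober : Set₁
  Sober = ∀ C → Closed C → Irreducible C
        → (∃ λ x → C ≐ cl x) × (∀ x x′ → C ≐ cl x → C ≐ cl x′ → x ≡ x′)

  KOBasis : Set₁
  KOBasis = ∀ U → Open U → ∀ x → U x → ∃ λ K → KO K × K x × K ⊆ U

  DS : Set₁
  DS = KOBasis × Sober

  DuallyDirected : Pred (Subset Carrier) 0ℓ → Set₁
  DuallyDirected 𝓛 = (∃ λ A → 𝓛 A)
                   × (∀ A B → 𝓛 A → 𝓛 B → ∃ λ C → 𝓛 C × C ⊆ A × C ⊆ B)

  InS : Subset Carrier → Set₁
  InS Z = ∃ λ (𝓛 : Pred (Subset Carrier) 0ℓ) → (∀ K → 𝓛 K → KO K) × DuallyDirected 𝓛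
        × Z ≐ (λ x → ∀ K → 𝓛 K → K x)

  Rel : Set₁
  Rel = Carrier → Subset Carrier → Set

  Meets : ∀ {ℓ} → Subset Carrier → Pred Carrier ℓ → Set ℓ
  Meets Z U = ∃ λ x → Z x × U x

  m : ∀ {ℓ} → Rel → Pred Carrier ℓ → Pred Carrier (Level.suc 0ℓ Level.⊔ ℓ)
  m R U x = ∀ Z → R x Z → Meets Z U

  SMonotonic : Rel → Set₁
  SMonotonic R = (∀ x Z → R x Z → InS Z)
               × (∀ (U : Subset Carrier) → InD U → InD (m R U))
               × (∀ x Z → R x Z ⇔ (InS Z × (∀ (U : Subset Carrier) → InD U → m R U x → Meets Z U)))

module _ (X₁ X₂ : Space) where
  open Space X₁ renaming (Carrier to C₁)
  open Space X₂ renaming (Carrier to C₂)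

  h : ∀ {ℓ} → (C₁ → C₂ → Set) → Pred C₂ ℓ → Pred C₁ ℓ
  h S U x = ∀ y → S x y → U y

  Sinv : (C₁ → C₂ → Set) → Subset C₂ → Subset C₁
  Sinv S W x = ∃ λ y → W y × S x y

  MeetRelation : (C₁ → C₂ → Set) → Set₁
  MeetRelation S = (∀ (U : Subset C₂) → InD X₂ U → InD X₁ (h S U))
                 × (∀ x y → S x y ⇔ (∀ (U : Subset C₂) → InD X₂ U → (∀ y′ → S x y′ → U y′) → U y))

  ConditionA : Rel X₁ → Rel X₂ → (C₁ → C₂ → Set) → Set₁
  ConditionA R₁ R₂ S = ∀ x (U : Subset C₂) → InD X₂ U
    → (∃ λ y → S x y × R₂ y (∁ U)) ⇔ R₁ x (Sinv S (∁ U))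

  ConditionB : Rel X₁ → Rel X₂ → (C₁ → C₂ → Set) → Set₁
  ConditionB R₁ R₂ S = ∀ (U : Subset C₂) → InD X₂ U → h S (m X₂ R₂ U) ≐ m X₁ R₁ (h S U)

module Submission where

-- For U ∈ D(X) the set X − U lies in 𝒮(X), and R(x) is upward closed within
-- 𝒮(X) (a consequence of R(x) = ⋂ {L_V : x ∈ m_R(V)}); hence x ∈ m_R(U) iff
-- X − U ∉ R(x). Applied in X₂ this reads x ∈ h_S(m_{R₂}(U)) iff X₂ − U ∉ R₂[S(x)],
-- and applied in X₁ to h_S(U) ∈ D(X₁), using X₁ − h_S(U) = S⁻¹[X₂ − U], it reads
-- x ∈ m_{R₁}(h_S(U)) iff S⁻¹[X₂ − U] ∉ R₁(x). So condition B says that the negations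
-- of the two sides of condition A are equivalent, which classically is condition A.

open import Defs
open import Level using (0ℓ)
open import Axiom.ExcludedMiddle using (ExcludedMiddle)
open import Axiom.DoubleNegationElimination using (em⇒dne)
open import Function.Base using (id)
open import Function.Bundles using (_⇔_; mk⇔; module Equivalence)
open import Data.Product using (∃; _×_; _,_; proj₁; proj₂)
open import Relation.Nullary using (¬_)
open import Relation.Unary using (_⊆_; _≐_; ∁)
open import Relation.Unary.Properties using (≐-refl; ≐-sym; ≐-trans)

open Equivalence

⇔-of-negations : ExcludedMiddle 0ℓ → ∀ {a b} {P Q : Set} {A : Set a} {B : Set b}
               → A ⇔ (¬ P) → B ⇔ (¬ Q) → (P ⇔ Q) ⇔ (A ⇔ B)
⇔-of-negations em A⇔¬P B⇔¬Q = mk⇔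
  (λ P⇔Q → mk⇔ (λ a → from B⇔¬Q (λ q → to A⇔¬P a (from P⇔Q q)))
               (λ b → from A⇔¬P (λ p → to B⇔¬Q b (to P⇔Q p))))
  (λ A⇔B → mk⇔ (λ p → em⇒dne em (λ ¬q → to A⇔¬P (from A⇔B (from B⇔¬Q ¬q)) p))
               (λ q → em⇒dne em (λ ¬p → to B⇔¬Q (to A⇔B (from A⇔¬P ¬p)) q)))

module _ (X : Space) where
  open Space X

  Compact-resp-≐ : ∀ {A K : Subset Carrier} → A ≐ K → Compact X K → Compact X A
  Compact-resp-≐ (A⊆K , K⊆A) compactK I F open-F A⊆⋃F
    with compactK I F open-F (λ k → A⊆⋃F (K⊆A k))
  ... | is , K⊆⋃Fis = is , (λ a → K⊆⋃Fis (A⊆K a))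

  -- W is the meet of the dually directed family {A : A ≐ K}.
  KO⇒InS : ∀ {K W : Subset Carrier} → KO X K → K ≐ W → InS X W
  KO⇒InS {K} (compactK , openK) (K⊆W , W⊆K) =
      (λ A → A ≐ K)
    , (λ A A≐K → Compact-resp-≐ A≐K compactK , open-resp (≐-sym A≐K) openK)
    , ((K , ≐-refl) , (λ A _ A≐K B≐K → A , A≐K , id , λ a → proj₂ B≐K (proj₁ A≐K a)))
    , (λ w A A≐K → proj₂ A≐K (W⊆K w)) , (λ inAll → K⊆W (inAll K ≐-refl))

  InD⇒InS : ∀ {U W : Subset Carrier} → InD X U → ∁ U ≐ W → InS X W
  InD⇒InS (K , KO-K , K≐∁U) ∁U≐W = KO⇒InS KO-K (≐-trans K≐∁U ∁U≐W)

  R-upward : ∀ {R : Rel X} → SMonotonic X R → ∀ {x Z W}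
           → R x Z → Z ⊆ W → InS X W → R x W
  R-upward (_ , _ , R⇔) {x} {Z} {W} RxZ Z⊆W InS-W = from (R⇔ x W)
    (InS-W , λ V D-V x∈mV → let (z , z∈Z , z∈V) = proj₂ (to (R⇔ x Z) RxZ) V D-V x∈mV
                             in z , Z⊆W z∈Z , z∈V)

  m⇔¬R∁ : ExcludedMiddle 0ℓ → ∀ {R : Rel X} → SMonotonic X R
        → ∀ {U W : Subset Carrier} → InD X U → ∁ U ≐ W → ∀ {x} → m X R U x ⇔ (¬ R x W)
  m⇔¬R∁ em sm {U} {W} D-U (∁U⊆W , W⊆∁U) = mk⇔
    (λ x∈mU RxW → W∩U≡∅ (x∈mU W RxW))
    (λ ¬RxW Z RxZ → em⇒dne em λ ¬Z∩U →
      ¬RxW (R-upward sm RxZ (λ z∈Z → ∁U⊆W (λ z∈U → ¬Z∩U (_ , z∈Z , z∈U)))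
                        (InD⇒InS D-U (∁U⊆W , W⊆∁U))))
    where
    W∩U≡∅ : ¬ Meets X W U
    W∩U≡∅ (_ , w∈W , w∈U) = W⊆∁U w∈W w∈U

module _ (X₁ X₂ : Space) {S : Space.Carrier X₁ → Space.Carrier X₂ → Set} where

  ∁h≐Sinv∁ : ExcludedMiddle 0ℓ → ∀ {U : Subset (Space.Carrier X₂)}
           → ∁ (h X₁ X₂ S U) ≐ Sinv X₁ X₂ S (∁ U)
  ∁h≐Sinv∁ em =
      (λ x∉hU → em⇒dne em λ ¬∃ → x∉hU λ y Sxy → em⇒dne em λ y∉U → ¬∃ (y , y∉U , Sxy))
    , (λ (y , y∉U , Sxy) x∈hU → y∉U (x∈hU y Sxy))

  h-m⇔¬R∁ : ExcludedMiddle 0ℓ → ∀ {R₂ : Rel X₂} → SMonotonic X₂ R₂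
          → ∀ {U} → InD X₂ U → ∀ {x}
          → h X₁ X₂ S (m X₂ R₂ U) x ⇔ (¬ ∃ λ y → S x y × R₂ y (∁ U))
  h-m⇔¬R∁ em sm D-U = mk⇔
    (λ x∈hmU (y , Sxy , R₂y∁U) → to (m⇔¬R∁ X₂ em sm D-U ≐-refl) (x∈hmU y Sxy) R₂y∁U)
    (λ ¬∃ y Sxy → from (m⇔¬R∁ X₂ em sm D-U ≐-refl) (λ R₂y∁U → ¬∃ (y , Sxy , R₂y∁U)))

  m-h⇔¬R∁ : ExcludedMiddle 0ℓ → ∀ {R₁ : Rel X₁} → SMonotonic X₁ R₁ → MeetRelation X₁ X₂ S
          → ∀ {U} → InD X₂ U → ∀ {x}
          → m X₁ R₁ (h X₁ X₂ S U) x ⇔ (¬ R₁ x (Sinv X₁ X₂ S (∁ U)))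
  m-h⇔¬R∁ em sm (h-D , _) {U} D-U = m⇔¬R∁ X₁ em sm (h-D U D-U) (∁h≐Sinv∁ em)

mainTheorem10 : ExcludedMiddle 0ℓ
    → (X₁ X₂ : Space) (R₁ : Rel X₁) (R₂ : Rel X₂)
    → DS X₁ → SMonotonic X₁ R₁ → DS X₂ → SMonotonic X₂ R₂
    → (S : Space.Carrier X₁ → Space.Carrier X₂ → Set) → MeetRelation X₁ X₂ S
    → ConditionA X₁ X₂ R₁ R₂ S ⇔ ConditionB X₁ X₂ R₁ R₂ S
mainTheorem10 em X₁ X₂ R₁ R₂ _ sm₁ _ sm₂ S meetS = mk⇔
  (λ condA U D-U → (λ {x} → to (to (A⇔B x U D-U) (condA x U D-U)))
                 , (λ {x} → from (to (A⇔B x U D-U) (condA x U D-U))))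
  (λ condB x U D-U → from (A⇔B x U D-U) (mk⇔ (proj₁ (condB U D-U) {x}) (proj₂ (condB U D-U) {x})))
  where
  A⇔B : ∀ x U → InD X₂ U
      → ((∃ λ y → S x y × R₂ y (∁ U)) ⇔ R₁ x (Sinv X₁ X₂ S (∁ U)))
      ⇔ (h X₁ X₂ S (m X₂ R₂ U) x ⇔ m X₁ R₁ (h X₁ X₂ S U) x)
  A⇔B x U D-U = ⇔-of-negations em (h-m⇔¬R∁ X₁ X₂ {S} em sm₂ D-U {x})
                                     (m-h⇔¬R∁ X₁ X₂ em sm₁ meetS D-U)
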